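{- Let $p>3$ be a prime. Then for each $k=1,2,\ldots,(p-1)/2$, $$\sum_{j=2}^{p-2k}\frac{\binom{k+j-1}{k}}{k+j}\equiv(-1)^k\left(\frac32\sum_{j=1}^k\frac{\binom{2j}{j}}{j}-\frac{\binom{2k}{k}}{k}\right)-\frac1{k+1}\pmod p.$$
   Context: Congruences between rationals are understood in the ring of rationals whose denominators are coprime to $p$. -}

module Defs where

open import Data.Nat as ℕ using (ℕ; zero; suc; _∸_)
open import Data.Nat.Combinatorics using (_C_)
open import Data.Nat.Divisibility using (_∣_)
open import Data.Integer as ℤ using (ℤ; +_)
open import Data.Rational as ℚ using (ℚ; ↥_; ↧ₙ_; _+_; _-_; _*_; _/_; 0ℚ)
open import Data.List using (List; foldr; map)
open import Data.List using (upTo)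
open import Relation.Nullary using (¬_)
open import Data.Product using (_×_)

-- Σ_{j=a}^{b} f j  (empty if b < a)
sumFromTo : ℕ → ℕ → (ℕ → ℚ) → ℚ
sumFromTo a b f = foldr _+_ 0ℚ (map (λ i → f (a ℕ.+ i)) (upTo (suc b ∸ a)))

-- x ≡ y (mod p) in the ring Z_(p) of rationals with denominator coprime to p:
-- x - y (in lowest terms) has denominator not divisible by p and
-- numerator divisible by p.
_≡_[modℚ_] : ℚ → ℚ → ℕ → Set
x ≡ y [modℚ p ] = ¬ (p ∣ ↧ₙ (x - y)) × (p ∣ ℤ.∣ ↥ (x - y) ∣)

sgn : ℕ → ℚ
sgn zero = ℚ.1ℚ
sgn (suc k) = ℚ.- sgn k

lhsTerm : ℕ → ℕ → ℚ
lhsTerm k zero = 0ℚ  -- never used (j ranges from 2)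
lhsTerm k (suc j') = (+ ((k ℕ.+ j') C k)) / (suc (k ℕ.+ j'))
  -- with j = suc j': k + j - 1 = k + j', k + j = suc (k + j')

centralTerm : ℕ → ℚ
centralTerm zero = 0ℚ  -- never used (j ranges from 1; k ≥ 1)
centralTerm (suc j') = (+ ((2 ℕ.* suc j') C suc j')) / suc j'

-- The left side is S(k, p-2k-1), where S(k, L) = Σ_{j=2}^{L+1} C(k+j-1,k)/(k+j). Pairing
-- the j-th term of S(k+1, L) with the (j+1)-th term of S(k, L+2) and using the absorption
-- identity (k+1) C(n+1,k+1) = (n+1) C(n,k) together with the hockey-stick identity gives
-- S(k+1, L) + S(k, L+2) exactly in terms of C(N,k+1), C(N,k) and 1/(N+1), where N = p-k-1.
-- Modulo p, C(p-1-a, b) ≡ (-1)^b C(a+b, b) and 1/(N+1) ≡ -1/k turn these into central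
-- binomial coefficients, and the result agrees with the sum of the right-hand sides for
-- k+1 and k. So the congruence follows by induction on k; the base case k = 1 reduces to
-- the harmonic sum H_{p-1} ≡ 0 (mod p).

module Submission where

open import Defs
open import Function using (_∘_)
open import Data.Nat as ℕ using (ℕ; zero; suc; _∸_; _<_; _≤_; s≤s; z≤n) renaming (_*_ to _*ℕ_)
import Data.Nat.Properties as ℕ
open import Data.Nat.Combinatorics using (_C_; nC1≡n; nCk≡nC[n∸k]; nCk+nC[k+1]≡[n+1]C[k+1])
open import Data.Nat.Divisibility using (_∣_; _∤_; divides; >⇒∤; ∣-trans)
open import Data.Nat.Coprimality as Coprimality using (coprime-divisor)
open import Data.Nat.Primality using (Prime; euclidsLemma; prime⇒nonTrivial)
open import Data.Nat.Tactic.RingSolver using (solve-∀)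
open import Data.Integer as ℤ using (ℤ; +_)
import Data.Integer.Properties as ℤ
open import Data.Rational as ℚ using (ℚ; mkℚ; _+_; _-_; _*_; _/_; 0ℚ; 1ℚ; toℚᵘ; fromℚᵘ)
import Data.Rational.Properties as ℚ
open import Data.Rational.Unnormalised as ℚᵘ using (mkℚᵘ; *≡*)
import Data.Rational.Unnormalised.Properties as ℚᵘ
open import Data.Rational.Solver using (module +-*-Solver)
open import Data.List using (foldr; map; applyUpTo)
open import Data.Product using (_×_; _,_)
open import Data.Sum using (inj₁; inj₂)
open import Data.Empty using (⊥-elim)
open import Relation.Binary.Structures using (IsEquivalence)
open import Relation.Binary.Bundles using (Setoid)
open import Relation.Binary.PropositionalEquality
import Relation.Binary.Reasoning.Setoid

open +-*-Solver

-- Finite sums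

∑ : (ℕ → ℚ) → ℕ → ℚ
∑ f zero = 0ℚ
∑ f (suc n) = f 0 + ∑ (f ∘ suc) n

foldr-map-applyUpTo : ∀ (f : ℕ → ℚ) g n → foldr _+_ 0ℚ (map f (applyUpTo g n)) ≡ ∑ (f ∘ g) n
foldr-map-applyUpTo f g zero = refl
foldr-map-applyUpTo f g (suc n) = cong (_+_ (f (g 0))) (foldr-map-applyUpTo f (g ∘ suc) n)

sumFromTo≡∑ : ∀ a b f → sumFromTo a b f ≡ ∑ (λ i → f (a ℕ.+ i)) (suc b ∸ a)
sumFromTo≡∑ a b f = foldr-map-applyUpTo (λ i → f (a ℕ.+ i)) (λ i → i) (suc b ∸ a)

∑-cong : ∀ {f g} n → (∀ i → f i ≡ g i) → ∑ f n ≡ ∑ g n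
∑-cong zero f≡g = refl
∑-cong (suc n) f≡g = cong₂ _+_ (f≡g 0) (∑-cong n (f≡g ∘ suc))

∑-last : ∀ f n → ∑ f (suc n) ≡ ∑ f n + f n
∑-last f zero = trans (ℚ.+-identityʳ (f 0)) (sym (ℚ.+-identityˡ (f 0)))
∑-last f (suc n) = begin
  f 0 + ∑ (f ∘ suc) (suc n)     ≡⟨ cong (_+_ (f 0)) (∑-last (f ∘ suc) n) ⟩
  f 0 + (∑ (f ∘ suc) n + f (suc n)) ≡⟨ ℚ.+-assoc (f 0) _ _ ⟨
  f 0 + ∑ (f ∘ suc) n + f (suc n) ∎
  where open ≡-Reasoning

∑-distrib-+ : ∀ f g n → ∑ (λ i → f i + g i) n ≡ ∑ f n + ∑ g n
∑-distrib-+ f g zero = refl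
∑-distrib-+ f g (suc n) = begin
  f 0 + g 0 + ∑ (λ i → f (suc i) + g (suc i)) n ≡⟨ cong (_+_ (f 0 + g 0)) (∑-distrib-+ (f ∘ suc) (g ∘ suc) n) ⟩
  f 0 + g 0 + (∑ (f ∘ suc) n + ∑ (g ∘ suc) n)   ≡⟨ solve 4 (λ a b c d → a :+ b :+ (c :+ d) := a :+ c :+ (b :+ d)) refl (f 0) (g 0) _ _ ⟩
  f 0 + ∑ (f ∘ suc) n + (g 0 + ∑ (g ∘ suc) n)   ∎
  where open ≡-Reasoning

∑-distribʳ-* : ∀ f c n → ∑ (λ i → f i * c) n ≡ ∑ f n * c
∑-distribʳ-* f c zero = sym (ℚ.*-zeroˡ c)
∑-distribʳ-* f c (suc n) = trans (cong (_+_ (f 0 * c)) (∑-distribʳ-* (f ∘ suc) c n)) (sym (ℚ.*-distribʳ-+ c (f 0) _))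

∑-reverse : ∀ f n → ∑ f n ≡ ∑ (λ i → f (n ∸ suc i)) n
∑-reverse f zero = refl
∑-reverse f (suc n) = begin
  ∑ f (suc n)                        ≡⟨ ∑-last f n ⟩
  ∑ f n + f n                        ≡⟨ cong (_+ f n) (∑-reverse f n) ⟩
  ∑ (λ i → f (n ∸ suc i)) n + f n    ≡⟨ ℚ.+-comm _ (f n) ⟩
  f n + ∑ (λ i → f (n ∸ suc i)) n    ∎
  where open ≡-Reasoning

-- Binomial coefficients

[1+k]*[1+n]C[1+k]≡[1+n]*nCk : ∀ n k → suc k ℕ.* (suc n C suc k) ≡ suc n ℕ.* (n C k)
[1+k]*[1+n]C[1+k]≡[1+n]*nCk n zero =
  trans (ℕ.*-identityˡ _) (trans (nC1≡n (suc n)) (sym (ℕ.*-identityʳ (suc n))))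
[1+k]*[1+n]C[1+k]≡[1+n]*nCk zero (suc k) = ℕ.*-zeroʳ (suc (suc k))
[1+k]*[1+n]C[1+k]≡[1+n]*nCk (suc n) (suc k) = begin
  suc (suc k) ℕ.* (suc (suc n) C suc (suc k))
    ≡⟨ cong (suc (suc k) ℕ.*_) (nCk+nC[k+1]≡[n+1]C[k+1] (suc n) (suc k)) ⟨
  suc (suc k) ℕ.* (x ℕ.+ y)
    ≡⟨ split k x y ⟩
  x ℕ.+ suc k ℕ.* x ℕ.+ suc (suc k) ℕ.* y
    ≡⟨ cong₂ (λ u v → x ℕ.+ u ℕ.+ v) ([1+k]*[1+n]C[1+k]≡[1+n]*nCk n k) ([1+k]*[1+n]C[1+k]≡[1+n]*nCk n (suc k)) ⟩
  x ℕ.+ suc n ℕ.* (n C k) ℕ.+ suc n ℕ.* (n C suc k)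
    ≡⟨ merge x n (n C k) (n C suc k) ⟩
  x ℕ.+ suc n ℕ.* (n C k ℕ.+ n C suc k)
    ≡⟨ cong (λ u → x ℕ.+ suc n ℕ.* u) (nCk+nC[k+1]≡[n+1]C[k+1] n k) ⟩
  suc (suc n) ℕ.* (suc n C suc k) ∎
  where
  open ≡-Reasoning
  x = suc n C suc k
  y = suc n C suc (suc k)
  split : ∀ k x y → (2 ℕ.+ k) ℕ.* (x ℕ.+ y) ≡ x ℕ.+ (1 ℕ.+ k) ℕ.* x ℕ.+ (2 ℕ.+ k) ℕ.* y
  split = solve-∀
  merge : ∀ x n a b → x ℕ.+ (1 ℕ.+ n) ℕ.* a ℕ.+ (1 ℕ.+ n) ℕ.* b ≡ x ℕ.+ (1 ℕ.+ n) ℕ.* (a ℕ.+ b)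
  merge = solve-∀

[m+n]Cm≡[m+n]Cn : ∀ m n → (m ℕ.+ n) C m ≡ (m ℕ.+ n) C n
[m+n]Cm≡[m+n]Cn m n = trans (nCk≡nC[n∸k] (ℕ.m≤m+n m n)) (cong ((m ℕ.+ n) C_) (ℕ.m+n∸m≡n m n))

[1+a]*[1+a+b]Cb≡[1+b]*[1+a+b]C[1+b] : ∀ a b → suc a ℕ.* (suc (a ℕ.+ b) C b) ≡ suc b ℕ.* (suc (a ℕ.+ b) C suc b)
[1+a]*[1+a+b]Cb≡[1+b]*[1+a+b]C[1+b] a b = begin
  suc a ℕ.* (suc (a ℕ.+ b) C b)      ≡⟨ cong (suc a ℕ.*_) ([m+n]Cm≡[m+n]Cn (suc a) b) ⟨
  suc a ℕ.* (suc (a ℕ.+ b) C suc a)  ≡⟨ [1+k]*[1+n]C[1+k]≡[1+n]*nCk (a ℕ.+ b) a ⟩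
  suc (a ℕ.+ b) ℕ.* ((a ℕ.+ b) C a)  ≡⟨ cong (suc (a ℕ.+ b) ℕ.*_) ([m+n]Cm≡[m+n]Cn a b) ⟩
  suc (a ℕ.+ b) ℕ.* ((a ℕ.+ b) C b)  ≡⟨ [1+k]*[1+n]C[1+k]≡[1+n]*nCk (a ℕ.+ b) b ⟨
  suc b ℕ.* (suc (a ℕ.+ b) C suc b)  ∎
  where open ≡-Reasoning

[2+2k]C[1+k]≡[1+2k]C[1+k]+[1+2k]C[1+k] : ∀ k → (2 ℕ.* suc k) C suc k ≡ (k ℕ.+ suc k) C suc k ℕ.+ (k ℕ.+ suc k) C suc k
[2+2k]C[1+k]≡[1+2k]C[1+k]+[1+2k]C[1+k] k = begin
  (2 ℕ.* suc k) C suc k                                ≡⟨ cong (_C suc k) (cong suc (cong (k ℕ.+_) (ℕ.+-identityʳ (suc k)))) ⟩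
  suc (k ℕ.+ suc k) C suc k                            ≡⟨ nCk+nC[k+1]≡[n+1]C[k+1] (k ℕ.+ suc k) k ⟨
  (k ℕ.+ suc k) C k ℕ.+ (k ℕ.+ suc k) C suc k           ≡⟨ cong (ℕ._+ (k ℕ.+ suc k) C suc k) ([m+n]Cm≡[m+n]Cn k (suc k)) ⟩
  (k ℕ.+ suc k) C suc k ℕ.+ (k ℕ.+ suc k) C suc k       ∎
  where open ≡-Reasoning

[1+n]Cn≡1+n : ∀ n → suc n C n ≡ suc n
[1+n]Cn≡1+n n = begin
  suc n C n          ≡⟨ cong (_C n) (ℕ.+-comm 1 n) ⟩
  (n ℕ.+ 1) C n      ≡⟨ [m+n]Cm≡[m+n]Cn n 1 ⟩
  (n ℕ.+ 1) C 1      ≡⟨ nC1≡n (n ℕ.+ 1) ⟩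
  n ℕ.+ 1            ≡⟨ ℕ.+-comm n 1 ⟩
  suc n              ∎
  where open ≡-Reasoning

-- ℤ and ℕ inside ℚ

fromℚᵘ-homo-+ : ∀ x y → fromℚᵘ (x ℚᵘ.+ y) ≡ fromℚᵘ x + fromℚᵘ y
fromℚᵘ-homo-+ x y = ℚ.toℚᵘ-injective (ℚᵘ.≃-trans (ℚ.toℚᵘ-fromℚᵘ (x ℚᵘ.+ y))
  (ℚᵘ.≃-sym (ℚᵘ.≃-trans (ℚ.toℚᵘ-homo-+ (fromℚᵘ x) (fromℚᵘ y)) (ℚᵘ.+-cong (ℚ.toℚᵘ-fromℚᵘ x) (ℚ.toℚᵘ-fromℚᵘ y)))))

fromℚᵘ-homo-* : ∀ x y → fromℚᵘ (x ℚᵘ.* y) ≡ fromℚᵘ x * fromℚᵘ y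
fromℚᵘ-homo-* x y = ℚ.toℚᵘ-injective (ℚᵘ.≃-trans (ℚ.toℚᵘ-fromℚᵘ (x ℚᵘ.* y))
  (ℚᵘ.≃-sym (ℚᵘ.≃-trans (ℚ.toℚᵘ-homo-* (fromℚᵘ x) (fromℚᵘ y)) (ℚᵘ.*-cong (ℚ.toℚᵘ-fromℚᵘ x) (ℚ.toℚᵘ-fromℚᵘ y)))))

fromℚᵘ-homo‿- : ∀ x → fromℚᵘ (ℚᵘ.- x) ≡ ℚ.- fromℚᵘ x
fromℚᵘ-homo‿- x = ℚ.toℚᵘ-injective (ℚᵘ.≃-trans (ℚ.toℚᵘ-fromℚᵘ (ℚᵘ.- x))
  (ℚᵘ.≃-sym (ℚᵘ.≃-trans (ℚ.toℚᵘ-homo‿- (fromℚᵘ x)) (ℚᵘ.-‿cong (ℚ.toℚᵘ-fromℚᵘ x)))))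

-- Opaque so that unification treats fromℤ and 1/suc as rigid (their normal forms are gcd
-- computations); they are used only through the lemmas proved alongside them.
opaque
  fromℤ : ℤ → ℚ
  fromℤ i = i / 1

  fromℤ-homo-+ : ∀ a b → fromℤ (a ℤ.+ b) ≡ fromℤ a + fromℤ b
  fromℤ-homo-+ a b = trans (ℚ.fromℚᵘ-cong {mkℚᵘ (a ℤ.+ b) 0} {mkℚᵘ a 0 ℚᵘ.+ mkℚᵘ b 0} (*≡* eq))
    (fromℚᵘ-homo-+ (mkℚᵘ a 0) (mkℚᵘ b 0))
    where
    eq : (a ℤ.+ b) ℤ.* + 1 ≡ (a ℤ.* + 1 ℤ.+ b ℤ.* + 1) ℤ.* + 1
    eq = cong (ℤ._* + 1) (sym (cong₂ ℤ._+_ (ℤ.*-identityʳ a) (ℤ.*-identityʳ b)))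

  fromℤ-homo-* : ∀ a b → fromℤ (a ℤ.* b) ≡ fromℤ a * fromℤ b
  fromℤ-homo-* a b = fromℚᵘ-homo-* (mkℚᵘ a 0) (mkℚᵘ b 0)

  fromℤ-homo‿- : ∀ a → fromℤ (ℤ.- a) ≡ ℚ.- fromℤ a
  fromℤ-homo‿- a = fromℚᵘ-homo‿- (mkℚᵘ a 0)

  fromℤ≡/1 : ∀ i → fromℤ i ≡ i / 1
  fromℤ≡/1 i = refl

  toℚᵘ-fromℤ : ∀ a → toℚᵘ (fromℤ a) ℚᵘ.≃ mkℚᵘ a 0
  toℚᵘ-fromℤ a = ℚ.toℚᵘ-fromℚᵘ (mkℚᵘ a 0)

  fromℤ-0 : fromℤ (+ 0) ≡ 0ℚ
  fromℤ-0 = refl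

  fromℤ-1 : fromℤ (+ 1) ≡ 1ℚ
  fromℤ-1 = refl

fromℕ : ℕ → ℚ
fromℕ n = fromℤ (+ n)

fromℕ-homo-+ : ∀ m n → fromℕ (m ℕ.+ n) ≡ fromℕ m + fromℕ n
fromℕ-homo-+ m n = fromℤ-homo-+ (+ m) (+ n)

fromℕ-homo-* : ∀ m n → fromℕ (m ℕ.* n) ≡ fromℕ m * fromℕ n
fromℕ-homo-* m n = trans (cong fromℤ (ℤ.pos-* m n)) (fromℤ-homo-* (+ m) (+ n))

fromℕ-suc : ∀ n → fromℕ (suc n) ≡ 1ℚ + fromℕ n
fromℕ-suc n = trans (fromℕ-homo-+ 1 n) (cong (_+ fromℕ n) fromℤ-1)

opaque
  unfolding fromℤ

  1/suc : ℕ → ℚ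
  1/suc n = + 1 / suc n

  +c/[1+n]≡c*1/suc[n] : ∀ c n → + c / suc n ≡ fromℕ c * 1/suc n
  +c/[1+n]≡c*1/suc[n] c n = trans (ℚ.fromℚᵘ-cong {mkℚᵘ (+ c) n} {mkℚᵘ (+ c) 0 ℚᵘ.* mkℚᵘ (+ 1) n} (*≡* eq))
    (fromℚᵘ-homo-* (mkℚᵘ (+ c) 0) (mkℚᵘ (+ 1) n))
    where
    eq : + c ℤ.* + (1 ℕ.* suc n) ≡ (+ c ℤ.* + 1) ℤ.* + suc n
    eq = cong₂ ℤ._*_ (sym (ℤ.*-identityʳ (+ c))) (cong +_ (ℕ.*-identityˡ (suc n)))

  +1/[1+n]≡1/suc[n] : ∀ n → + 1 / suc n ≡ 1/suc n
  +1/[1+n]≡1/suc[n] n = refl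

  [1+n]*1/suc[n]≡1 : ∀ n → fromℕ (suc n) * 1/suc n ≡ 1ℚ
  [1+n]*1/suc[n]≡1 n = trans (sym (fromℚᵘ-homo-* (mkℚᵘ (+ suc n) 0) (mkℚᵘ (+ 1) n)))
    (ℚ.fromℚᵘ-cong {mkℚᵘ (+ suc n) 0 ℚᵘ.* mkℚᵘ (+ 1) n} {mkℚᵘ (+ 1) 0} (*≡* eq))
    where
    eq : (+ suc n ℤ.* + 1) ℤ.* + 1 ≡ + 1 ℤ.* + (1 ℕ.* suc n)
    eq = trans (ℤ.*-identityʳ _) (trans (ℤ.*-identityʳ _) (sym (trans (ℤ.*-identityˡ _) (cong +_ (ℕ.*-identityˡ (suc n))))))

fromℕ-*-cong : ∀ {a b c d} → a ℕ.* b ≡ c ℕ.* d → fromℕ a * fromℕ b ≡ fromℕ c * fromℕ d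
fromℕ-*-cong {a} {b} {c} {d} ab≡cd = trans (sym (fromℕ-homo-* a b)) (trans (cong fromℕ ab≡cd) (fromℕ-homo-* c d))

a*1/suc[d]≡e*1/suc[m] : ∀ {a d e m} → a ℕ.* suc m ≡ e ℕ.* suc d → fromℕ a * 1/suc d ≡ fromℕ e * 1/suc m
a*1/suc[d]≡e*1/suc[m] {a} {d} {e} {m} a[1+m]≡e[1+d] = begin
  fromℕ a * 1/suc d                                         ≡⟨ ℚ.*-identityʳ _ ⟨
  fromℕ a * 1/suc d * 1ℚ                                    ≡⟨ cong (fromℕ a * 1/suc d *_) ([1+n]*1/suc[n]≡1 m) ⟨
  fromℕ a * 1/suc d * (fromℕ (suc m) * 1/suc m)
    ≡⟨ solve 4 (λ a d M m → a :* d :* (M :* m) := (a :* M) :* d :* m) refl (fromℕ a) (1/suc d) (fromℕ (suc m)) (1/suc m) ⟩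
  (fromℕ a * fromℕ (suc m)) * 1/suc d * 1/suc m             ≡⟨ cong (λ t → t * 1/suc d * 1/suc m) (fromℕ-*-cong a[1+m]≡e[1+d]) ⟩
  (fromℕ e * fromℕ (suc d)) * 1/suc d * 1/suc m
    ≡⟨ solve 4 (λ e D d m → (e :* D) :* d :* m := e :* (D :* d) :* m) refl (fromℕ e) (fromℕ (suc d)) (1/suc d) (1/suc m) ⟩
  fromℕ e * (fromℕ (suc d) * 1/suc d) * 1/suc m             ≡⟨ cong (λ t → fromℕ e * t * 1/suc m) ([1+n]*1/suc[n]≡1 d) ⟩
  fromℕ e * 1ℚ * 1/suc m                                    ≡⟨ cong (_* 1/suc m) (ℚ.*-identityʳ (fromℕ e)) ⟩
  fromℕ e * 1/suc m                                         ∎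
  where open ≡-Reasoning

∑-const-1 : ∀ n → ∑ (λ _ → 1ℚ) n ≡ fromℕ n
∑-const-1 zero = sym fromℤ-0
∑-const-1 (suc n) = trans (cong (_+_ 1ℚ) (∑-const-1 n)) (sym (fromℕ-suc n))

-- The exact recurrence

lhsSum : ℕ → ℕ → ℚ
lhsSum k L = ∑ (λ i → lhsTerm k (2 ℕ.+ i)) L

rhs : ℕ → ℚ
rhs k = sgn k * ((+ 3 / 2) * sumFromTo 1 k centralTerm - centralTerm k) - (+ 1 / suc k)

lhsTerm-suc : ∀ k j → lhsTerm k (suc j) ≡ fromℕ ((k ℕ.+ j) C k) * 1/suc (k ℕ.+ j)
lhsTerm-suc k j = +c/[1+n]≡c*1/suc[n] ((k ℕ.+ j) C k) (k ℕ.+ j)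

centralTerm-suc : ∀ j → centralTerm (suc j) ≡ fromℕ ((2 ℕ.* suc j) C suc j) * 1/suc j
centralTerm-suc j = +c/[1+n]≡c*1/suc[n] ((2 ℕ.* suc j) C suc j) j

lhsTerm-pair : ∀ m i → lhsTerm (suc m) (2 ℕ.+ i) + lhsTerm m (3 ℕ.+ i) ≡ fromℕ ((2 ℕ.+ m ℕ.+ i) C m) * 1/suc m
lhsTerm-pair m i = begin
  lhsTerm (suc m) (2 ℕ.+ i) + lhsTerm m (3 ℕ.+ i)
    ≡⟨ cong₂ _+_ (lhsTerm-suc (suc m) (suc i)) (lhsTerm-suc m (2 ℕ.+ i)) ⟩
  fromℕ ((suc m ℕ.+ suc i) C suc m) * 1/suc (suc m ℕ.+ suc i) + fromℕ ((m ℕ.+ (2 ℕ.+ i)) C m) * 1/suc (m ℕ.+ (2 ℕ.+ i))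
    ≡⟨ cong₂ (λ u v → fromℕ (u C suc m) * 1/suc u + fromℕ (v C m) * 1/suc v) 1+m+1+i≡N m+2+i≡N ⟩
  fromℕ (N C suc m) * 1/suc N + fromℕ (N C m) * 1/suc N
    ≡⟨ solve 3 (λ x y w → x :* w :+ y :* w := (y :+ x) :* w) refl (fromℕ (N C suc m)) (fromℕ (N C m)) (1/suc N) ⟩
  (fromℕ (N C m) + fromℕ (N C suc m)) * 1/suc N
    ≡⟨ cong (_* 1/suc N) (trans (sym (fromℕ-homo-+ (N C m) (N C suc m))) (cong fromℕ (nCk+nC[k+1]≡[n+1]C[k+1] N m))) ⟩
  fromℕ (suc N C suc m) * 1/suc N
    ≡⟨ a*1/suc[d]≡e*1/suc[m] (trans (ℕ.*-comm _ (suc m)) (trans ([1+k]*[1+n]C[1+k]≡[1+n]*nCk N m) (ℕ.*-comm (suc N) (N C m)))) ⟩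
  fromℕ (N C m) * 1/suc m ∎
  where
  open ≡-Reasoning
  N = 2 ℕ.+ m ℕ.+ i
  1+m+1+i≡N : suc m ℕ.+ suc i ≡ N
  1+m+1+i≡N = cong suc (ℕ.+-suc m i)
  m+2+i≡N : m ℕ.+ (2 ℕ.+ i) ≡ N
  m+2+i≡N = trans (ℕ.+-suc m (suc i)) (cong suc (ℕ.+-suc m i))

∑C-hockey-stick : ∀ c m L → ∑ (λ i → fromℕ ((c ℕ.+ i) C m)) L + fromℕ (c C suc m) ≡ fromℕ ((c ℕ.+ L) C suc m)
∑C-hockey-stick c m zero = trans (ℚ.+-identityˡ _) (cong (λ n → fromℕ (n C suc m)) (sym (ℕ.+-identityʳ c)))
∑C-hockey-stick c m (suc L) = begin
  ∑ f (suc L) + fromℕ (c C suc m)                       ≡⟨ cong (_+ fromℕ (c C suc m)) (∑-last f L) ⟩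
  ∑ f L + f L + fromℕ (c C suc m)                       ≡⟨ solve 3 (λ x y z → x :+ y :+ z := (x :+ z) :+ y) refl (∑ f L) (f L) (fromℕ (c C suc m)) ⟩
  ∑ f L + fromℕ (c C suc m) + f L                       ≡⟨ cong (_+ f L) (∑C-hockey-stick c m L) ⟩
  fromℕ ((c ℕ.+ L) C suc m) + fromℕ ((c ℕ.+ L) C m)     ≡⟨ ℚ.+-comm (fromℕ ((c ℕ.+ L) C suc m)) (fromℕ ((c ℕ.+ L) C m)) ⟩
  fromℕ ((c ℕ.+ L) C m) + fromℕ ((c ℕ.+ L) C suc m)     ≡⟨ fromℕ-homo-+ _ _ ⟨
  fromℕ ((c ℕ.+ L) C m ℕ.+ (c ℕ.+ L) C suc m)           ≡⟨ cong fromℕ (nCk+nC[k+1]≡[n+1]C[k+1] (c ℕ.+ L) m) ⟩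
  fromℕ (suc (c ℕ.+ L) C suc m)                         ≡⟨ cong (λ n → fromℕ (n C suc m)) (ℕ.+-suc c L) ⟨
  fromℕ ((c ℕ.+ suc L) C suc m)                         ∎
  where
  open ≡-Reasoning
  f : ℕ → ℚ
  f i = fromℕ ((c ℕ.+ i) C m)

-- The unpaired first and last terms of lhsSum m (2 + L), and the paired terms summed by the
-- hockey-stick identity.
stepClosedForm : ℕ → ℕ → ℚ
stepClosedForm m L =
  fromℕ (suc m) * 1/suc (suc m) + (fromℕ (N C suc m) - fromℕ (2 ℕ.+ m)) * 1/suc m + fromℕ (N C m) * 1/suc N
  where N = 2 ℕ.+ m ℕ.+ L

lhsSum-step : ∀ m L → lhsSum (suc m) L + lhsSum m (2 ℕ.+ L) ≡ stepClosedForm m L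
lhsSum-step m L = begin
  lhsSum (suc m) L + (first + ∑ g (suc L))
    ≡⟨ cong (λ t → lhsSum (suc m) L + (first + t)) (∑-last g L) ⟩
  lhsSum (suc m) L + (first + (∑ g L + last))
    ≡⟨ solve 4 (λ a b c d → a :+ (b :+ (c :+ d)) := (a :+ c) :+ b :+ d) refl (lhsSum (suc m) L) first (∑ g L) last ⟩
  (lhsSum (suc m) L + ∑ g L) + first + last
    ≡⟨ cong₂ (λ u v → u + first + v) paired last≡ ⟩
  (fromℕ (N C suc m) - fromℕ (2 ℕ.+ m)) * 1/suc m + first + fromℕ (N C m) * 1/suc N
    ≡⟨ cong (λ t → (fromℕ (N C suc m) - fromℕ (2 ℕ.+ m)) * 1/suc m + t + fromℕ (N C m) * 1/suc N) first≡ ⟩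
  (fromℕ (N C suc m) - fromℕ (2 ℕ.+ m)) * 1/suc m + fromℕ (suc m) * 1/suc (suc m) + fromℕ (N C m) * 1/suc N
    ≡⟨ cong (_+ fromℕ (N C m) * 1/suc N) (ℚ.+-comm _ (fromℕ (suc m) * 1/suc (suc m))) ⟩
  fromℕ (suc m) * 1/suc (suc m) + (fromℕ (N C suc m) - fromℕ (2 ℕ.+ m)) * 1/suc m + fromℕ (N C m) * 1/suc N ∎
  where
  open ≡-Reasoning
  N = 2 ℕ.+ m ℕ.+ L
  g : ℕ → ℚ
  g i = lhsTerm m (3 ℕ.+ i)
  first = lhsTerm m 2
  last = g L
  first≡ : first ≡ fromℕ (suc m) * 1/suc (suc m)
  first≡ = trans (lhsTerm-suc m 1) (trans (cong (λ n → fromℕ (n C m) * 1/suc n) (ℕ.+-comm m 1))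
             (cong (λ c → fromℕ c * 1/suc (suc m)) ([1+n]Cn≡1+n m)))
  last≡ : last ≡ fromℕ (N C m) * 1/suc N
  last≡ = trans (lhsTerm-suc m (2 ℕ.+ L)) (cong (λ n → fromℕ (n C m) * 1/suc n)
            (trans (ℕ.+-suc m (suc L)) (cong suc (ℕ.+-suc m L))))
  paired : lhsSum (suc m) L + ∑ g L ≡ (fromℕ (N C suc m) - fromℕ (2 ℕ.+ m)) * 1/suc m
  paired = begin
    lhsSum (suc m) L + ∑ g L                                       ≡⟨ ∑-distrib-+ _ g L ⟨
    ∑ (λ i → lhsTerm (suc m) (2 ℕ.+ i) + g i) L                     ≡⟨ ∑-cong L (lhsTerm-pair m) ⟩
    ∑ (λ i → fromℕ ((2 ℕ.+ m ℕ.+ i) C m) * 1/suc m) L                ≡⟨ ∑-distribʳ-* _ (1/suc m) L ⟩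
    ∑ (λ i → fromℕ ((2 ℕ.+ m ℕ.+ i) C m)) L * 1/suc m                ≡⟨ cong (_* 1/suc m) hockey ⟩
    (fromℕ (N C suc m) - fromℕ (2 ℕ.+ m)) * 1/suc m                 ∎
    where
    S = ∑ (λ i → fromℕ ((2 ℕ.+ m ℕ.+ i) C m)) L
    hockey : S ≡ fromℕ (N C suc m) - fromℕ (2 ℕ.+ m)
    hockey = begin
      S                                                   ≡⟨ solve 2 (λ s x → s := s :+ x :- x) refl S (fromℕ (2 ℕ.+ m)) ⟩
      S + fromℕ (2 ℕ.+ m) - fromℕ (2 ℕ.+ m)                ≡⟨ cong (λ c → S + fromℕ c - fromℕ (2 ℕ.+ m)) ([1+n]Cn≡1+n (suc m)) ⟨
      S + fromℕ ((2 ℕ.+ m) C suc m) - fromℕ (2 ℕ.+ m)      ≡⟨ cong (_- fromℕ (2 ℕ.+ m)) (∑C-hockey-stick (2 ℕ.+ m) m L) ⟩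
      fromℕ (N C suc m) - fromℕ (2 ℕ.+ m)                  ∎

rhs≡ : ∀ k → rhs k ≡ sgn k * ((+ 3 / 2) * ∑ (centralTerm ∘ suc) k - centralTerm k) - 1/suc k
rhs≡ k = cong₂ (λ s r → sgn k * ((+ 3 / 2) * s - centralTerm k) - r) (sumFromTo≡∑ 1 k centralTerm) (+1/[1+n]≡1/suc[n] k)

rhsStep : ℕ → ℚ
rhsStep m = sgn (suc m) * ((+ 1 / 2) * centralTerm (suc m) + centralTerm m) - 1/suc (suc m) - 1/suc m

rhs-step : ∀ m → rhs (suc m) + rhs m ≡ rhsStep m
rhs-step m = begin
  rhs (suc m) + rhs m
    ≡⟨ cong₂ _+_ (rhs≡ (suc m)) (rhs≡ m) ⟩
  ℚ.- s * (+ 3 / 2 * ∑ c (suc m) - c m) - 1/suc (suc m) + (s * (+ 3 / 2 * ∑ c m - c₀) - 1/suc m)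
    ≡⟨ cong (λ t → ℚ.- s * (+ 3 / 2 * t - c m) - 1/suc (suc m) + (s * (+ 3 / 2 * ∑ c m - c₀) - 1/suc m)) (∑-last c m) ⟩
  ℚ.- s * (+ 3 / 2 * (∑ c m + c m) - c m) - 1/suc (suc m) + (s * (+ 3 / 2 * ∑ c m - c₀) - 1/suc m)
    ≡⟨ solve 6 (λ s A c₁ c₀ u v → (:- s) :* (con (+ 3 / 2) :* (A :+ c₁) :- c₁) :- u :+ (s :* (con (+ 3 / 2) :* A :- c₀) :- v)
                                  := (:- s) :* (con (+ 1 / 2) :* c₁ :+ c₀) :- u :- v)
             refl s (∑ c m) (c m) c₀ (1/suc (suc m)) (1/suc m) ⟩
  ℚ.- s * (+ 1 / 2 * c m + c₀) - 1/suc (suc m) - 1/suc m ∎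
  where
  open ≡-Reasoning
  s = sgn m
  c = centralTerm ∘ suc
  c₀ = centralTerm m

lhsSum-one : ∀ L → lhsSum 1 L ≡ fromℕ L - ∑ (λ i → 1/suc (2 ℕ.+ i)) L
lhsSum-one L = begin
  lhsSum 1 L                             ≡⟨ solve 2 (λ t w → t := (t :+ w) :- w) refl (lhsSum 1 L) (∑ w L) ⟩
  (lhsSum 1 L + ∑ w L) - ∑ w L           ≡⟨ cong (_- ∑ w L) (trans (sym (∑-distrib-+ _ w L)) (∑-cong L term+w≡1)) ⟩
  ∑ (λ _ → 1ℚ) L - ∑ w L                 ≡⟨ cong (_- ∑ w L) (∑-const-1 L) ⟩
  fromℕ L - ∑ w L                        ∎
  where
  open ≡-Reasoning
  w : ℕ → ℚ
  w i = 1/suc (2 ℕ.+ i)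
  term+w≡1 : ∀ i → lhsTerm 1 (2 ℕ.+ i) + w i ≡ 1ℚ
  term+w≡1 i = begin
    lhsTerm 1 (2 ℕ.+ i) + w i                         ≡⟨ cong (_+ w i) (lhsTerm-suc 1 (suc i)) ⟩
    fromℕ ((2 ℕ.+ i) C 1) * w i + w i                 ≡⟨ cong (λ c → fromℕ c * w i + w i) (nC1≡n (2 ℕ.+ i)) ⟩
    fromℕ (2 ℕ.+ i) * w i + w i                       ≡⟨ solve 2 (λ n w → n :* w :+ w := (con 1ℚ :+ n) :* w) refl (fromℕ (2 ℕ.+ i)) (w i) ⟩
    (1ℚ + fromℕ (2 ℕ.+ i)) * w i                      ≡⟨ cong (_* w i) (fromℕ-suc (2 ℕ.+ i)) ⟨
    fromℕ (3 ℕ.+ i) * w i                             ≡⟨ [1+n]*1/suc[n]≡1 (2 ℕ.+ i) ⟩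
    1ℚ                                                ∎

[1+k]/[2+k]-[2+k]/[1+k]≡-1/[2+k]-1/[1+k] : ∀ k →
  fromℕ (suc k) * 1/suc (suc k) - fromℕ (2 ℕ.+ k) * 1/suc k ≡ ℚ.- 1/suc (suc k) - 1/suc k
[1+k]/[2+k]-[2+k]/[1+k]≡-1/[2+k]-1/[1+k] k = begin
  A * w₁ - fromℕ (2 ℕ.+ k) * w₀           ≡⟨ cong (λ t → A * w₁ - t * w₀) (fromℕ-suc (suc k)) ⟩
  A * w₁ - (1ℚ + A) * w₀
    ≡⟨ solve 3 (λ A w₁ w₀ → A :* w₁ :- (con 1ℚ :+ A) :* w₀ := ((con 1ℚ :+ A) :* w₁ :- w₁) :- (w₀ :+ A :* w₀)) refl A w₁ w₀ ⟩
  ((1ℚ + A) * w₁ - w₁) - (w₀ + A * w₀)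
    ≡⟨ cong₂ (λ a b → (a - w₁) - (w₀ + b)) (trans (cong (_* w₁) (sym (fromℕ-suc (suc k)))) ([1+n]*1/suc[n]≡1 (suc k))) ([1+n]*1/suc[n]≡1 k) ⟩
  (1ℚ - w₁) - (w₀ + 1ℚ)                   ≡⟨ solve 2 (λ w₁ w₀ → (con 1ℚ :- w₁) :- (w₀ :+ con 1ℚ) := :- w₁ :- w₀) refl w₁ w₀ ⟩
  ℚ.- w₁ - w₀                             ∎
  where
  open ≡-Reasoning
  A = fromℕ (suc k)
  w₁ = 1/suc (suc k)
  w₀ = 1/suc k

-- Congruences modulo p

module Congruence (p : ℕ) (p-prime : Prime p) where

  p∤m*n : ∀ {m n} → p ∤ m → p ∤ n → p ∤ m ℕ.* n
  p∤m*n {m} {n} p∤m p∤n p∣m*n with euclidsLemma m n p-prime p∣m*n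
  ... | inj₁ p∣m = p∤m p∣m
  ... | inj₂ p∣n = p∤n p∣n

  p∤1 : p ∤ 1
  p∤1 = >⇒∤ (ℕ.nonTrivial⇒n>1 p {{prime⇒nonTrivial p-prime}})

  -- x ∈ ℤ₍ₚ₎; _≈_ below is congruence modulo p in that ring.
  record Integral (x : ℚ) : Set where
    constructor integral
    field
      den : ℕ
      num : ℤ
      p∤den : p ∤ den
      x*den≡num : x * fromℕ den ≡ fromℤ num

  fromℤ-integral : ∀ a → Integral (fromℤ a)
  fromℤ-integral a = integral 1 a p∤1 (trans (cong (fromℤ a *_) fromℤ-1) (ℚ.*-identityʳ (fromℤ a)))

  fromℕ-integral : ∀ n → Integral (fromℕ n)
  fromℕ-integral n = fromℤ-integral (+ n)

  1/suc-integral : ∀ {n} → p ∤ suc n → Integral (1/suc n)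
  1/suc-integral {n} p∤1+n =
    integral (suc n) (+ 1) p∤1+n (trans (ℚ.*-comm (1/suc n) (fromℕ (suc n))) (trans ([1+n]*1/suc[n]≡1 n) (sym fromℤ-1)))

  +-integral : ∀ {x y} → Integral x → Integral y → Integral (x + y)
  +-integral {x} {y} (integral b a p∤b xb≡a) (integral d c p∤d yd≡c) =
    integral (b ℕ.* d) (a ℤ.* + d ℤ.+ c ℤ.* + b) (p∤m*n p∤b p∤d) (begin
      (x + y) * fromℕ (b ℕ.* d)                     ≡⟨ cong ((x + y) *_) (fromℕ-homo-* b d) ⟩
      (x + y) * (fromℕ b * fromℕ d)                 ≡⟨ solve 4 (λ x y b d → (x :+ y) :* (b :* d) := x :* b :* d :+ y :* d :* b) refl x y (fromℕ b) (fromℕ d) ⟩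
      x * fromℕ b * fromℕ d + y * fromℕ d * fromℕ b ≡⟨ cong₂ (λ u v → u * fromℕ d + v * fromℕ b) xb≡a yd≡c ⟩
      fromℤ a * fromℕ d + fromℤ c * fromℕ b         ≡⟨ cong₂ _+_ (fromℤ-homo-* a (+ d)) (fromℤ-homo-* c (+ b)) ⟨
      fromℤ (a ℤ.* + d) + fromℤ (c ℤ.* + b)         ≡⟨ fromℤ-homo-+ (a ℤ.* + d) (c ℤ.* + b) ⟨
      fromℤ (a ℤ.* + d ℤ.+ c ℤ.* + b)               ∎)
    where open ≡-Reasoning

  *-integral : ∀ {x y} → Integral x → Integral y → Integral (x * y)
  *-integral {x} {y} (integral b a p∤b xb≡a) (integral d c p∤d yd≡c) =
    integral (b ℕ.* d) (a ℤ.* c) (p∤m*n p∤b p∤d) (begin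
      (x * y) * fromℕ (b ℕ.* d)       ≡⟨ cong ((x * y) *_) (fromℕ-homo-* b d) ⟩
      (x * y) * (fromℕ b * fromℕ d)   ≡⟨ solve 4 (λ x y b d → (x :* y) :* (b :* d) := (x :* b) :* (y :* d)) refl x y (fromℕ b) (fromℕ d) ⟩
      (x * fromℕ b) * (y * fromℕ d)   ≡⟨ cong₂ _*_ xb≡a yd≡c ⟩
      fromℤ a * fromℤ c               ≡⟨ fromℤ-homo-* a c ⟨
      fromℤ (a ℤ.* c)                 ∎)
    where open ≡-Reasoning

  -‿integral : ∀ {x} → Integral x → Integral (ℚ.- x)
  -‿integral {x} (integral b a p∤b xb≡a) = integral b (ℤ.- a) p∤b (begin
    ℚ.- x * fromℕ b      ≡⟨ ℚ.neg-distribˡ-* x (fromℕ b) ⟨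
    ℚ.- (x * fromℕ b)    ≡⟨ cong ℚ.-_ xb≡a ⟩
    ℚ.- fromℤ a          ≡⟨ fromℤ-homo‿- a ⟨
    fromℤ (ℤ.- a)        ∎)
    where open ≡-Reasoning

  sgn-integral : ∀ k → Integral (sgn k)
  sgn-integral zero = subst Integral fromℤ-1 (fromℕ-integral 1)
  sgn-integral (suc k) = -‿integral (sgn-integral k)

  infix 4 _≈_
  record _≈_ (x y : ℚ) : Set where
    constructor mk≈
    field
      {cofactor} : ℚ
      cofactor-integral : Integral cofactor
      x-y≡p*cofactor : x - y ≡ fromℕ p * cofactor

  ≈-reflexive : ∀ {x y} → x ≡ y → x ≈ y
  ≈-reflexive {x} refl = mk≈ (fromℕ-integral 0) (trans (ℚ.+-inverseʳ x) (sym (trans (cong (fromℕ p *_) fromℤ-0) (ℚ.*-zeroʳ (fromℕ p)))))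

  ≈-sym : ∀ {x y} → x ≈ y → y ≈ x
  ≈-sym {x} {y} (mk≈ {z} z-int eq) = mk≈ (-‿integral z-int) (begin
    y - x                 ≡⟨ solve 2 (λ x y → y :- x := :- (x :- y)) refl x y ⟩
    ℚ.- (x - y)           ≡⟨ cong ℚ.-_ eq ⟩
    ℚ.- (fromℕ p * z)     ≡⟨ ℚ.neg-distribʳ-* (fromℕ p) z ⟩
    fromℕ p * ℚ.- z       ∎)
    where open ≡-Reasoning

  ≈-trans : ∀ {x y z} → x ≈ y → y ≈ z → x ≈ z
  ≈-trans {x} {y} {z} (mk≈ {u} u-int eq₁) (mk≈ {v} v-int eq₂) = mk≈ (+-integral u-int v-int) (begin
    x - z                         ≡⟨ solve 3 (λ x y z → x :- z := (x :- y) :+ (y :- z)) refl x y z ⟩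
    (x - y) + (y - z)             ≡⟨ cong₂ _+_ eq₁ eq₂ ⟩
    fromℕ p * u + fromℕ p * v     ≡⟨ ℚ.*-distribˡ-+ (fromℕ p) u v ⟨
    fromℕ p * (u + v)             ∎)
    where open ≡-Reasoning

  ≈-isEquivalence : IsEquivalence _≈_
  ≈-isEquivalence = record { refl = ≈-reflexive refl ; sym = ≈-sym ; trans = ≈-trans }

  ≈-setoid : Setoid _ _
  ≈-setoid = record { isEquivalence = ≈-isEquivalence }

  module ≈-Reasoning = Relation.Binary.Reasoning.Setoid ≈-setoid

  +-cong : ∀ {x x′ y y′} → x ≈ x′ → y ≈ y′ → x + y ≈ x′ + y′
  +-cong {x} {x′} {y} {y′} (mk≈ {u} u-int eq₁) (mk≈ {v} v-int eq₂) = mk≈ (+-integral u-int v-int) (begin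
    (x + y) - (x′ + y′)           ≡⟨ solve 4 (λ x x′ y y′ → (x :+ y) :- (x′ :+ y′) := (x :- x′) :+ (y :- y′)) refl x x′ y y′ ⟩
    (x - x′) + (y - y′)           ≡⟨ cong₂ _+_ eq₁ eq₂ ⟩
    fromℕ p * u + fromℕ p * v     ≡⟨ ℚ.*-distribˡ-+ (fromℕ p) u v ⟨
    fromℕ p * (u + v)             ∎)
    where open ≡-Reasoning

  -‿cong : ∀ {x y} → x ≈ y → ℚ.- x ≈ ℚ.- y
  -‿cong {x} {y} (mk≈ {z} z-int eq) = mk≈ (-‿integral z-int) (begin
    ℚ.- x - ℚ.- y          ≡⟨ solve 2 (λ x y → :- x :- :- y := :- (x :- y)) refl x y ⟩
    ℚ.- (x - y)            ≡⟨ cong ℚ.-_ eq ⟩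
    ℚ.- (fromℕ p * z)      ≡⟨ ℚ.neg-distribʳ-* (fromℕ p) z ⟩
    fromℕ p * ℚ.- z        ∎)
    where open ≡-Reasoning

  *-congˡ : ∀ {w x y} → Integral w → x ≈ y → w * x ≈ w * y
  *-congˡ {w} {x} {y} w-int (mk≈ {z} z-int eq) = mk≈ (*-integral w-int z-int) (begin
    w * x - w * y          ≡⟨ solve 3 (λ w x y → w :* x :- w :* y := w :* (x :- y)) refl w x y ⟩
    w * (x - y)            ≡⟨ cong (w *_) eq ⟩
    w * (fromℕ p * z)      ≡⟨ solve 3 (λ w p z → w :* (p :* z) := p :* (w :* z)) refl w (fromℕ p) z ⟩
    fromℕ p * (w * z)      ∎)
    where open ≡-Reasoning

  *-cong : ∀ {x x′ y y′} → Integral x → Integral y′ → x ≈ x′ → y ≈ y′ → x * y ≈ x′ * y′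
  *-cong {x} {x′} {y} {y′} x-int y′-int x≈x′ y≈y′ = begin
    x * y     ≈⟨ *-congˡ x-int y≈y′ ⟩
    x * y′    ≡⟨ ℚ.*-comm x y′ ⟩
    y′ * x    ≈⟨ *-congˡ y′-int x≈x′ ⟩
    y′ * x′   ≡⟨ ℚ.*-comm y′ x′ ⟩
    x′ * y′   ∎
    where open ≈-Reasoning

  *-cancelˡ : ∀ {c x y} → p ∤ suc c → fromℕ (suc c) * x ≈ fromℕ (suc c) * y → x ≈ y
  *-cancelˡ {c} {x} {y} p∤1+c cx≈cy = begin
    x                                  ≡⟨ cancel x ⟨
    1/suc c * (fromℕ (suc c) * x)      ≈⟨ *-congˡ (1/suc-integral p∤1+c) cx≈cy ⟩
    1/suc c * (fromℕ (suc c) * y)      ≡⟨ cancel y ⟩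
    y                                  ∎
    where
    open ≈-Reasoning
    cancel : ∀ z → 1/suc c * (fromℕ (suc c) * z) ≡ z
    cancel z = trans (sym (ℚ.*-assoc (1/suc c) (fromℕ (suc c)) z))
      (trans (cong (_* z) (trans (ℚ.*-comm (1/suc c) (fromℕ (suc c))) ([1+n]*1/suc[n]≡1 c))) (ℚ.*-identityˡ z))

  m+n≡p⇒m≈-n : ∀ {m n} → m ℕ.+ n ≡ p → fromℕ m ≈ ℚ.- fromℕ n
  m+n≡p⇒m≈-n {m} {n} m+n≡p = mk≈ (fromℕ-integral 1) (begin
    fromℕ m - ℚ.- fromℕ n     ≡⟨ solve 2 (λ x y → x :- (:- y) := x :+ y) refl (fromℕ m) (fromℕ n) ⟩
    fromℕ m + fromℕ n         ≡⟨ fromℕ-homo-+ m n ⟨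
    fromℕ (m ℕ.+ n)           ≡⟨ cong fromℕ m+n≡p ⟩
    fromℕ p                   ≡⟨ ℚ.*-identityʳ (fromℕ p) ⟨
    fromℕ p * 1ℚ              ≡⟨ cong (fromℕ p *_) fromℤ-1 ⟨
    fromℕ p * fromℕ 1         ∎)
    where open ≡-Reasoning

  q*b≡p*a⇒p∤↧q×p∣↥q : ∀ q {b a} → p ∤ b → q * fromℕ b ≡ fromℤ (+ p ℤ.* a) →
                      p ∤ ℚ.↧ₙ q × p ∣ ℤ.∣ ℚ.↥ q ∣
  q*b≡p*a⇒p∤↧q×p∣↥q q@(mkℚ n d n⊥d) {b} {a} p∤b qb≡pa = p∤1+d , p∣n
    where
    open ≡-Reasoning
    ≃-form : mkℚᵘ n d ℚᵘ.* mkℚᵘ (+ b) 0 ℚᵘ.≃ mkℚᵘ (+ p ℤ.* a) 0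
    ≃-form = ℚᵘ.≃-trans (ℚᵘ.*-cong (ℚᵘ.≃-refl {mkℚᵘ n d}) (ℚᵘ.≃-sym (toℚᵘ-fromℤ (+ b))))
      (ℚᵘ.≃-trans (ℚᵘ.≃-sym (ℚ.toℚᵘ-homo-* q (fromℕ b)))
        (ℚᵘ.≃-trans (ℚ.toℚᵘ-cong qb≡pa) (toℚᵘ-fromℤ (+ p ℤ.* a))))
    ∣n∣*b≡p*∣a∣*[1+d] : ℤ.∣ n ∣ ℕ.* b ≡ p ℕ.* ℤ.∣ a ∣ ℕ.* suc d
    ∣n∣*b≡p*∣a∣*[1+d] = begin
      ℤ.∣ n ∣ ℕ.* b                            ≡⟨ ℤ.abs-* n (+ b) ⟨
      ℤ.∣ n ℤ.* + b ∣                          ≡⟨ cong ℤ.∣_∣ (ℤ.*-identityʳ (n ℤ.* + b)) ⟨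
      ℤ.∣ n ℤ.* + b ℤ.* + 1 ∣                  ≡⟨ cong ℤ.∣_∣ (ℚᵘ.drop-*≡* ≃-form) ⟩
      ℤ.∣ + p ℤ.* a ℤ.* (+ suc d ℤ.* + 1) ∣    ≡⟨ cong (λ t → ℤ.∣ + p ℤ.* a ℤ.* t ∣) (ℤ.*-identityʳ (+ suc d)) ⟩
      ℤ.∣ + p ℤ.* a ℤ.* + suc d ∣              ≡⟨ ℤ.abs-* (+ p ℤ.* a) (+ suc d) ⟩
      ℤ.∣ + p ℤ.* a ∣ ℕ.* suc d                ≡⟨ cong (ℕ._* suc d) (ℤ.abs-* (+ p) a) ⟩
      p ℕ.* ℤ.∣ a ∣ ℕ.* suc d                  ∎
    p∣n : p ∣ ℤ.∣ n ∣
    p∣n with euclidsLemma ℤ.∣ n ∣ b p-prime (divides (ℤ.∣ a ∣ ℕ.* suc d)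
               (trans ∣n∣*b≡p*∣a∣*[1+d] (trans (ℕ.*-assoc p _ _) (ℕ.*-comm p _))))
    ... | inj₁ p∣n = p∣n
    ... | inj₂ p∣b = ⊥-elim (p∤b p∣b)
    p∤1+d : p ∤ suc d
    p∤1+d p∣1+d = p∤b (∣-trans p∣1+d
      (coprime-divisor (Coprimality.sym (Coprimality.recompute n⊥d)) (divides (p ℕ.* ℤ.∣ a ∣) ∣n∣*b≡p*∣a∣*[1+d])))

  ≈⇒≡[modℚ] : ∀ {x y} → x ≈ y → x ≡ y [modℚ p ]
  ≈⇒≡[modℚ] {x} {y} (mk≈ {z} (integral b a p∤b zb≡a) eq) = q*b≡p*a⇒p∤↧q×p∣↥q (x - y) p∤b (begin
    (x - y) * fromℕ b             ≡⟨ cong (_* fromℕ b) eq ⟩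
    fromℕ p * z * fromℕ b         ≡⟨ ℚ.*-assoc (fromℕ p) z (fromℕ b) ⟩
    fromℕ p * (z * fromℕ b)       ≡⟨ cong (fromℕ p *_) zb≡a ⟩
    fromℕ p * fromℤ a             ≡⟨ fromℤ-homo-* (+ p) a ⟨
    fromℤ (+ p ℤ.* a)             ∎)
    where open ≡-Reasoning

  1/suc-reflect : ∀ {i j} → suc i ℕ.+ suc j ≡ p → 1/suc i ≈ ℚ.- 1/suc j
  1/suc-reflect {i} {j} e = begin
    1/suc i                                       ≡⟨ ℚ.*-identityʳ (1/suc i) ⟨
    1/suc i * 1ℚ                                  ≡⟨ cong (1/suc i *_) ([1+n]*1/suc[n]≡1 j) ⟨
    1/suc i * (fromℕ (suc j) * 1/suc j)           ≡⟨ solve 3 (λ u v J → u :* (J :* v) := (u :* v) :* J) refl (1/suc i) (1/suc j) (fromℕ (suc j)) ⟩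
    (1/suc i * 1/suc j) * fromℕ (suc j)           ≈⟨ *-congˡ (*-integral (1/suc-integral (>⇒∤ i<p)) (1/suc-integral (>⇒∤ j<p)))
                                                       (m+n≡p⇒m≈-n {suc j} {suc i} (trans (ℕ.+-comm (suc j) (suc i)) e)) ⟩
    (1/suc i * 1/suc j) * ℚ.- fromℕ (suc i)       ≡⟨ solve 3 (λ u v I → (u :* v) :* (:- I) := :- (v :* (I :* u))) refl (1/suc i) (1/suc j) (fromℕ (suc i)) ⟩
    ℚ.- (1/suc j * (fromℕ (suc i) * 1/suc i))     ≡⟨ cong (λ t → ℚ.- (1/suc j * t)) ([1+n]*1/suc[n]≡1 i) ⟩
    ℚ.- (1/suc j * 1ℚ)                            ≡⟨ cong ℚ.-_ (ℚ.*-identityʳ (1/suc j)) ⟩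
    ℚ.- 1/suc j                                   ∎
    where
    open ≈-Reasoning
    i<p : suc i < p
    i<p = ℕ.≤-trans (s≤s (ℕ.m≤m+n (suc i) j)) (ℕ.≤-reflexive (trans (sym (ℕ.+-suc (suc i) j)) e))
    j<p : suc j < p
    j<p = ℕ.≤-trans (s≤s (ℕ.m≤n+m (suc j) i)) (ℕ.≤-reflexive e)

  ∑≈0 : ∀ f n → (∀ i → i < n → f i ≈ 0ℚ) → ∑ f n ≈ 0ℚ
  ∑≈0 f zero _ = ≈-reflexive refl
  ∑≈0 f (suc n) f≈0 = ≈-trans (+-cong (f≈0 0 (s≤s z≤n)) (∑≈0 (f ∘ suc) n (λ i i<n → f≈0 (suc i) (s≤s i<n))))
                              (≈-reflexive (ℚ.+-identityˡ 0ℚ))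

  harmonic≈0 : 2 < p → ∀ {n} → suc n ≡ p → ∑ 1/suc n ≈ 0ℚ
  harmonic≈0 2<p {n} 1+n≡p = *-cancelˡ (>⇒∤ 2<p) (begin
    fromℕ 2 * ∑ 1/suc n                                ≡⟨ cong (_* ∑ 1/suc n) (trans (fromℕ-homo-+ 1 1) (cong₂ _+_ fromℤ-1 fromℤ-1)) ⟩
    (1ℚ + 1ℚ) * ∑ 1/suc n                              ≡⟨ solve 1 (λ h → (con 1ℚ :+ con 1ℚ) :* h := h :+ h) refl (∑ 1/suc n) ⟩
    ∑ 1/suc n + ∑ 1/suc n                              ≡⟨ cong (_+_ (∑ 1/suc n)) (∑-reverse 1/suc n) ⟩
    ∑ 1/suc n + ∑ (λ i → 1/suc (n ∸ suc i)) n          ≡⟨ ∑-distrib-+ 1/suc (λ i → 1/suc (n ∸ suc i)) n ⟨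
    ∑ (λ i → 1/suc i + 1/suc (n ∸ suc i)) n            ≈⟨ ∑≈0 _ n pair≈0 ⟩
    0ℚ                                                 ≡⟨ ℚ.*-zeroʳ (fromℕ 2) ⟨
    fromℕ 2 * 0ℚ                                       ∎)
    where
    open ≈-Reasoning
    pair≈0 : ∀ i → i < n → 1/suc i + 1/suc (n ∸ suc i) ≈ 0ℚ
    pair≈0 i i<n = ≈-trans (+-cong (1/suc-reflect e) (≈-reflexive refl)) (≈-reflexive (ℚ.+-inverseˡ (1/suc (n ∸ suc i))))
      where
      e : suc i ℕ.+ suc (n ∸ suc i) ≡ p
      e = trans (cong suc (trans (ℕ.+-suc i (n ∸ suc i)) (ℕ.m+[n∸m]≡n i<n))) 1+n≡p

  C-reflect : ∀ b {n a} → n ℕ.+ suc a ≡ p → b ≤ n → fromℕ (n C b) ≈ sgn b * fromℕ ((a ℕ.+ b) C b)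
  C-reflect zero _ _ = ≈-reflexive (sym (ℚ.*-identityˡ (fromℕ 1)))
  C-reflect (suc b) {suc n} {a} n+a+2≡p (s≤s b≤n) = *-cancelˡ (>⇒∤ 1+b<p) (begin
    fromℕ (suc b) * fromℕ (suc n C suc b)
      ≡⟨ fromℕ-*-cong ([1+k]*[1+n]C[1+k]≡[1+n]*nCk n b) ⟩
    fromℕ (suc n) * fromℕ (n C b)
      ≈⟨ *-cong (fromℕ-integral (suc n)) (*-integral (sgn-integral b) (fromℕ-integral _))
                (m+n≡p⇒m≈-n {suc n} {suc a} n+a+2≡p) (C-reflect b (trans (ℕ.+-suc n (suc a)) n+a+2≡p) b≤n) ⟩
    ℚ.- fromℕ (suc a) * (sgn b * fromℕ (suc (a ℕ.+ b) C b))
      ≡⟨ solve 3 (λ A s c → :- A :* (s :* c) := :- s :* (A :* c)) refl (fromℕ (suc a)) (sgn b) _ ⟩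
    sgn (suc b) * (fromℕ (suc a) * fromℕ (suc (a ℕ.+ b) C b))
      ≡⟨ cong (sgn (suc b) *_) (fromℕ-*-cong ([1+a]*[1+a+b]Cb≡[1+b]*[1+a+b]C[1+b] a b)) ⟩
    sgn (suc b) * (fromℕ (suc b) * fromℕ (suc (a ℕ.+ b) C suc b))
      ≡⟨ solve 3 (λ s B c → s :* (B :* c) := B :* (s :* c)) refl (sgn (suc b)) (fromℕ (suc b)) _ ⟩
    fromℕ (suc b) * (sgn (suc b) * fromℕ (suc (a ℕ.+ b) C suc b))
      ≡⟨ cong (λ m → fromℕ (suc b) * (sgn (suc b) * fromℕ (m C suc b))) (ℕ.+-suc a b) ⟨
    fromℕ (suc b) * (sgn (suc b) * fromℕ ((a ℕ.+ suc b) C suc b)) ∎)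
    where
    open ≈-Reasoning
    1+b<p : suc b < p
    1+b<p = ℕ.≤-trans (s≤s (s≤s b≤n)) (ℕ.≤-trans (s≤s (ℕ.m≤m+n (suc n) a)) (ℕ.≤-reflexive (trans (sym (ℕ.+-suc (suc n) a)) n+a+2≡p)))

-- The induction

module _ {p : ℕ} (p-prime : Prime p) where
  open Congruence p p-prime

  lhsSum-one≈rhs : ∀ {L} → 3 ℕ.+ L ≡ p → lhsSum 1 L ≈ rhs 1
  lhsSum-one≈rhs {L} 3+L≡p = begin
    lhsSum 1 L
      ≡⟨ lhsSum-one L ⟩
    fromℕ L - ∑ w L
      ≡⟨ solve 4 (λ x u₀ u₁ W → x :- W := x :- ((u₀ :+ (u₁ :+ W)) :- u₀ :- u₁)) refl (fromℕ L) (1/suc 0) (1/suc 1) (∑ w L) ⟩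
    fromℕ L - (∑ 1/suc (2 ℕ.+ L) - 1/suc 0 - 1/suc 1)
      ≈⟨ +-cong (m+n≡p⇒m≈-n {L} {3} (trans (ℕ.+-comm L 3) 3+L≡p))
                (-‿cong (+-cong (+-cong (harmonic≈0 (ℕ.≤-trans (ℕ.m≤m+n 3 L) (ℕ.≤-reflexive 3+L≡p)) 3+L≡p) (≈-reflexive refl)) (≈-reflexive refl))) ⟩
    ℚ.- fromℕ 3 - (0ℚ - 1/suc 0 - 1/suc 1)
      ≡⟨ cong₂ (λ a u → ℚ.- a - (0ℚ - u - 1/suc 1)) (fromℤ≡/1 (+ 3)) (sym (+1/[1+n]≡1/suc[n] 0)) ⟩
    ℚ.- (+ 3 / 1) - (0ℚ - + 1 / 1 - 1/suc 1)
      ≡⟨ cong (λ u → ℚ.- (+ 3 / 1) - (0ℚ - + 1 / 1 - u)) (sym (+1/[1+n]≡1/suc[n] 1)) ⟩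
    ℚ.- (+ 3 / 1) - (0ℚ - + 1 / 1 - + 1 / 2)
      ≡⟨⟩
    rhs 1 ∎
    where
    open ≈-Reasoning
    w : ℕ → ℚ
    w i = 1/suc (2 ℕ.+ i)

  C[N,1+k]*1/suc[k]≈half-central : ∀ k L → 2 ℕ.+ k ℕ.+ L ℕ.+ suc k ≡ p →
    fromℕ ((2 ℕ.+ k ℕ.+ L) C suc k) * 1/suc k ≈ sgn (suc k) * (+ 1 / 2 * centralTerm (suc k))
  C[N,1+k]*1/suc[k]≈half-central k L N+1+k≡p = begin
    fromℕ (N C suc k) * w
      ≈⟨ *-cong (fromℕ-integral _) (1/suc-integral (>⇒∤ 1+k<p))
                (C-reflect (suc k) {N} {k} N+1+k≡p (s≤s (ℕ.≤-trans (ℕ.m≤m+n k L) (ℕ.n≤1+n _)))) (≈-reflexive refl) ⟩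
    s * fromℕ X * w
      ≡⟨ solve 3 (λ s x w → s :* x :* w := s :* (con (+ 1 / 2) :* ((x :+ x) :* w))) refl s (fromℕ X) w ⟩
    s * (+ 1 / 2 * ((fromℕ X + fromℕ X) * w))
      ≡⟨ cong (λ t → s * (+ 1 / 2 * (t * w))) (fromℕ-homo-+ X X) ⟨
    s * (+ 1 / 2 * (fromℕ (X ℕ.+ X) * w))
      ≡⟨ cong (λ c → s * (+ 1 / 2 * (fromℕ c * w))) ([2+2k]C[1+k]≡[1+2k]C[1+k]+[1+2k]C[1+k] k) ⟨
    s * (+ 1 / 2 * (fromℕ ((2 ℕ.* suc k) C suc k) * w))
      ≡⟨ cong (λ t → s * (+ 1 / 2 * t)) (centralTerm-suc k) ⟨
    s * (+ 1 / 2 * centralTerm (suc k)) ∎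
    where
    open ≈-Reasoning
    N = 2 ℕ.+ k ℕ.+ L
    X = (k ℕ.+ suc k) C suc k
    w = 1/suc k
    s = sgn (suc k)
    1+k<p : suc k < p
    1+k<p = ℕ.≤-trans (s≤s (ℕ.m≤n+m (suc k) (suc (k ℕ.+ L)))) (ℕ.≤-reflexive N+1+k≡p)

  C[N,k]*1/suc[N]≈central : ∀ m L → let k = suc m ; N = 2 ℕ.+ k ℕ.+ L in N ℕ.+ suc k ≡ p →
    fromℕ (N C k) * 1/suc N ≈ sgn (suc k) * centralTerm k
  C[N,k]*1/suc[N]≈central m L N+1+k≡p = begin
    fromℕ (N C k) * 1/suc N
      ≈⟨ *-cong (fromℕ-integral _) (-‿integral (1/suc-integral (>⇒∤ 1+m<p)))
                (C-reflect k {N} {k} N+1+k≡p (ℕ.≤-trans (ℕ.m≤m+n k L) (ℕ.≤-trans (ℕ.n≤1+n _) (ℕ.n≤1+n _))))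
                (1/suc-reflect (trans (sym (ℕ.+-suc N (suc m))) N+1+k≡p)) ⟩
    sgn k * fromℕ ((k ℕ.+ k) C k) * ℚ.- 1/suc m
      ≡⟨ solve 3 (λ s x w → s :* x :* (:- w) := (:- s) :* (x :* w)) refl (sgn k) (fromℕ ((k ℕ.+ k) C k)) (1/suc m) ⟩
    sgn (suc k) * (fromℕ ((k ℕ.+ k) C k) * 1/suc m)
      ≡⟨ cong (λ n → sgn (suc k) * (fromℕ ((k ℕ.+ n) C k) * 1/suc m)) (ℕ.+-identityʳ k) ⟨
    sgn (suc k) * (fromℕ ((2 ℕ.* k) C k) * 1/suc m)
      ≡⟨ cong (sgn (suc k) *_) (centralTerm-suc m) ⟨
    sgn (suc k) * centralTerm k ∎
    where
    open ≈-Reasoning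
    k = suc m
    N = 2 ℕ.+ k ℕ.+ L
    1+m<p : suc m < p
    1+m<p = ℕ.≤-trans (ℕ.m≤n+m (suc k) N) (ℕ.≤-reflexive N+1+k≡p)

  stepClosedForm≈rhsStep : ∀ m L → 2 ℕ.+ suc m ℕ.+ L ℕ.+ suc (suc m) ≡ p → stepClosedForm (suc m) L ≈ rhsStep (suc m)
  stepClosedForm≈rhsStep m L N+1+k≡p = begin
    A * w₁ + (fromℕ (N C suc k) - fromℕ (2 ℕ.+ k)) * w₀ + fromℕ (N C k) * 1/suc N
      ≡⟨ solve 6 (λ A w₁ X B w₀ Y → A :* w₁ :+ (X :- B) :* w₀ :+ Y := (A :* w₁ :- B :* w₀) :+ X :* w₀ :+ Y)
               refl A w₁ (fromℕ (N C suc k)) (fromℕ (2 ℕ.+ k)) w₀ (fromℕ (N C k) * 1/suc N) ⟩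
    (A * w₁ - fromℕ (2 ℕ.+ k) * w₀) + fromℕ (N C suc k) * w₀ + fromℕ (N C k) * 1/suc N
      ≈⟨ +-cong (+-cong (≈-reflexive ([1+k]/[2+k]-[2+k]/[1+k]≡-1/[2+k]-1/[1+k] k))
                        (C[N,1+k]*1/suc[k]≈half-central k L N+1+k≡p))
                (C[N,k]*1/suc[N]≈central m L N+1+k≡p) ⟩
    (ℚ.- w₁ - w₀) + s * (+ 1 / 2 * centralTerm (suc k)) + s * centralTerm k
      ≡⟨ solve 5 (λ w₁ w₀ s c₁ c₀ → (:- w₁ :- w₀) :+ s :* (con (+ 1 / 2) :* c₁) :+ s :* c₀ := s :* (con (+ 1 / 2) :* c₁ :+ c₀) :- w₁ :- w₀)
               refl w₁ w₀ s (centralTerm (suc k)) (centralTerm k) ⟩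
    s * (+ 1 / 2 * centralTerm (suc k) + centralTerm k) - w₁ - w₀ ∎
    where
    open ≈-Reasoning
    k = suc m
    N = 2 ℕ.+ k ℕ.+ L
    A = fromℕ (suc k)
    w₁ = 1/suc (suc k)
    w₀ = 1/suc k
    s = sgn (suc k)

  lhsSum≈rhs : ∀ m L → suc (suc m ℕ.+ suc m ℕ.+ L) ≡ p → lhsSum (suc m) L ≈ rhs (suc m)
  lhsSum≈rhs zero L 3+L≡p = lhsSum-one≈rhs 3+L≡p
  lhsSum≈rhs (suc m) L 2k+L+1≡p = begin
    lhsSum (suc k) L                                  ≡⟨ solve 2 (λ a b → a := (a :+ b) :- b) refl (lhsSum (suc k) L) S ⟩
    (lhsSum (suc k) L + S) - S                        ≡⟨ cong (_- S) (lhsSum-step k L) ⟩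
    stepClosedForm k L - S                            ≈⟨ +-cong (stepClosedForm≈rhsStep m L N+1+k≡p) (-‿cong (lhsSum≈rhs m (2 ℕ.+ L) IH-bound)) ⟩
    rhsStep k - rhs k                                 ≡⟨ cong (_- rhs k) (rhs-step k) ⟨
    (rhs (suc k) + rhs k) - rhs k                     ≡⟨ solve 2 (λ a b → (a :+ b) :- b := a) refl (rhs (suc k)) (rhs k) ⟩
    rhs (suc k)                                       ∎
    where
    open ≈-Reasoning
    k = suc m
    S = lhsSum k (2 ℕ.+ L)
    N+1+k≡p : 2 ℕ.+ k ℕ.+ L ℕ.+ suc k ≡ p
    N+1+k≡p = trans (rearrange k L) 2k+L+1≡p
      where
      rearrange : ∀ k L → 2 ℕ.+ k ℕ.+ L ℕ.+ suc k ≡ suc (suc k ℕ.+ suc k ℕ.+ L)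
      rearrange = solve-∀
    IH-bound : suc (k ℕ.+ k ℕ.+ (2 ℕ.+ L)) ≡ p
    IH-bound = trans (rearrange k L) 2k+L+1≡p
      where
      rearrange : ∀ k L → suc (k ℕ.+ k ℕ.+ (2 ℕ.+ L)) ≡ suc (suc k ℕ.+ suc k ℕ.+ L)
      rearrange = solve-∀

lemma2p3 : (p : ℕ) → Prime p → 3 < p →
           (k : ℕ) → 1 ≤ k → 2 *ℕ k ≤ p ∸ 1 →
           sumFromTo 2 (p ∸ 2 *ℕ k) (lhsTerm k)
             ≡ sgn k * ((+ 3 / 2) * sumFromTo 1 k centralTerm - centralTerm k)
               - (+ 1 / suc k)
             [modℚ p ]
lemma2p3 (suc p-1) p-prime _ (suc m) _ 2k≤p-1 =
  ≈⇒≡[modℚ] (≈-trans (≈-reflexive lhs≡lhsSum) (lhsSum≈rhs p-prime m L 2k+L+1≡p))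
  where
  open Congruence (suc p-1) p-prime
  L = p-1 ∸ 2 *ℕ suc m
  2k+L+1≡p : suc (suc m ℕ.+ suc m ℕ.+ L) ≡ suc p-1
  2k+L+1≡p = cong suc (trans (cong (ℕ._+ L) (cong (suc m ℕ.+_) (sym (ℕ.+-identityʳ (suc m))))) (ℕ.m+[n∸m]≡n 2k≤p-1))
  lhs≡lhsSum : sumFromTo 2 (suc p-1 ∸ 2 *ℕ suc m) (lhsTerm (suc m)) ≡ lhsSum (suc m) L
  lhs≡lhsSum = trans (sumFromTo≡∑ 2 (suc p-1 ∸ 2 *ℕ suc m) (lhsTerm (suc m)))
                     (cong (λ n → lhsSum (suc m) (suc n ∸ 2)) (ℕ.+-∸-assoc 1 2k≤p-1))
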